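{- Let $k\geq 2$ be an integer and let $l\in\{1,2\}$. Then there are infinitely many balanced bipartite graphs $G$ with $\delta(G)=k$ and $f(G)=\frac{|V(G)|}{2}+l$.
   Context: All graphs are finite and simple. A balanced bipartite graph is a bipartite graph with a bipartition into two parts of equal size. $\delta(G)$ is the minimum degree. The forest number $f(G)$ is the maximum cardinality of a set $S\subseteq V(G)$ such that the induced subgraph $G[S]$ is a forest. -}

module Defs where

open import Data.Nat using (ℕ; zero; suc; _+_; _≤_; _/_)
open import Data.Bool using (Bool; true; false; not; if_then_else_)
open import Data.Fin using (Fin)
open import Data.List using (List; []; _∷_; _++_; length; [_])
open import Data.List.Relation.Unary.All using (All)
open import Data.List.Relation.Unary.Unique.Propositional using (Unique)
open import Data.Product using (Σ; _×_; ∃; ∃-syntax; _,_)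
open import Data.Unit using (⊤)
open import Relation.Binary.PropositionalEquality using (_≡_)
open import Relation.Nullary using (¬_)

record Graph : Set where
  field
    order  : ℕ
    adj    : Fin order → Fin order → Bool
    symm   : ∀ u v → adj u v ≡ adj v u
    irrefl : ∀ v → adj v v ≡ false
open Graph public

count : ∀ {n} → (Fin n → Bool) → ℕ
count {zero}  p = 0
count {suc n} p = (if p Fin.zero then 1 else 0) + count (λ i → p (Fin.suc i))

VSet : Graph → Set
VSet G = Fin (order G) → Bool

∣_∣ : ∀ {G} → VSet G → ℕ
∣ S ∣ = count S

degree : (G : Graph) → Fin (order G) → ℕ
degree G v = count (adj G v)

MinDegreeIs : Graph → ℕ → Set
MinDegreeIs G k = (∀ v → k ≤ degree G v) × (∃[ v ] degree G v ≡ k)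

BalancedBipartite : Graph → Set
BalancedBipartite G =
  Σ (Fin (order G) → Bool) λ c →
    (∀ u v → adj G u v ≡ true → ¬ (c u ≡ c v)) × (count c ≡ count (λ v → not (c v)))

Walk : (G : Graph) → List (Fin (order G)) → Set
Walk G []           = ⊤
Walk G (x ∷ [])     = ⊤
Walk G (x ∷ y ∷ xs) = (adj G x y ≡ true) × Walk G (y ∷ xs)

CycleIn : (G : Graph) → VSet G → Set
CycleIn G S =
  Σ (Fin (order G)) λ x → Σ (List (Fin (order G))) λ xs →
    (2 ≤ length xs) × Unique (x ∷ xs) × All (λ v → S v ≡ true) (x ∷ xs)
    × Walk G (x ∷ xs ++ [ x ])

InducesForest : (G : Graph) → VSet G → Set
InducesForest G S = ¬ CycleIn G S

ForestNumberIs : Graph → ℕ → Set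
ForestNumberIs G m =
  (Σ (VSet G) λ S → InducesForest G S × count S ≡ m)
  × (∀ (S : VSet G) → InducesForest G S → count S ≤ m)

-- All examples are bipartite graphs on A = {a₀,…,a_{p−1}} and B = {b₀,…,b_{p−1}}. An induced forest
-- cannot contain two vertices of A and two of B that are completely joined
-- (they would span a 4-cycle). Conversely, A together with a set of B-vertices
-- no two of which have a common neighbour induces a star forest.
--
-- For l = 2 take the disjoint union of K_{k,k} and K_{m,m} with m ≥ k: an
-- induced forest meets each block in at most (its side) + 1 vertices, and A
-- together with one B-vertex from each block attains p + 2.
--
-- For l = 1 join a₀ to b₀,…,b_{k−1} and every other aᵢ to all of B. Then A
-- together with b₀ is a star, while an induced forest meets B at most once, or
-- A at most once, or A at most twice and {b₀,…,b_{k−1}} at most once; since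
-- k ≥ 2 each case leaves at most p + 1 vertices.
module Submission where

open import Defs
import Algebra.Properties.CommutativeSemigroup as CommutativeSemigroupProperties
open import Data.Bool using (Bool; true; false; not; _∧_; _∨_; if_then_else_)
open import Data.Bool.Properties using (∧-conicalˡ; ∧-conicalʳ; ∨-zeroʳ; not-injective)
open import Data.Empty using (⊥; ⊥-elim)
open import Data.Fin using (Fin; zero; suc; toℕ; _↑ˡ_; _↑ʳ_; splitAt)
open import Data.Fin.Properties using (splitAt-↑ˡ; splitAt-↑ʳ; join-splitAt; ↑ˡ-injective; ↑ʳ-injective; toℕ-injective; suc-injective)
open import Data.List using ([]; _∷_; _++_; [_])
open import Data.List.Relation.Unary.All using (All; []; _∷_)
open import Data.List.Relation.Unary.AllPairs using ([]; _∷_)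
open import Data.Nat using (ℕ; zero; suc; _+_; _*_; _≤_; _<_; z≤n; s≤s; s≤s⁻¹; z<s; _<ᵇ_; _≡ᵇ_; _≤?_; _/_)
open import Data.Nat.DivMod using (m*n/n≡m)
open import Data.Nat.Properties hiding (suc-injective)
open import Data.Product using (Σ; _×_; _,_)
open import Data.Sum using (_⊎_; inj₁; inj₂)
open import Data.Unit using (tt)
open import Function using (_∘_)
open import Relation.Binary.PropositionalEquality hiding ([_])
open import Relation.Nullary using (¬_; yes; no)

open CommutativeSemigroupProperties +-commutativeSemigroup using (interchange)

infixr 7 _∩_

_∩_ : ∀ {n} → (Fin n → Bool) → (Fin n → Bool) → Fin n → Bool
(P ∩ Q) i = P i ∧ Q i

∁ : ∀ {n} → (Fin n → Bool) → Fin n → Bool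
∁ P i = not (P i)

count-cong : ∀ {n} {P Q : Fin n → Bool} → (∀ i → P i ≡ Q i) → count P ≡ count Q
count-cong {zero}  P≗Q = refl
count-cong {suc n} P≗Q rewrite P≗Q zero = cong (_ +_) (count-cong (P≗Q ∘ suc))

count-false : ∀ n → count {n} (λ _ → false) ≡ 0
count-false zero    = refl
count-false (suc n) = count-false n

count-true : ∀ n → count {n} (λ _ → true) ≡ n
count-true zero    = refl
count-true (suc n) = cong suc (count-true n)

count-mono : ∀ {n} {P Q : Fin n → Bool} → (∀ i → P i ≡ true → Q i ≡ true) → count P ≤ count Q
count-mono {zero}          P⊆Q = z≤n
count-mono {suc n} {P} {Q} P⊆Q with P zero in P₀ | Q zero in Q₀
... | true  | true  = s≤s (count-mono (P⊆Q ∘ suc))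
... | true  | false with () ← trans (sym (P⊆Q zero P₀)) Q₀
... | false | true  = m≤n⇒m≤1+n (count-mono (P⊆Q ∘ suc))
... | false | false = count-mono (P⊆Q ∘ suc)

count-≤ : ∀ {n} (P : Fin n → Bool) → count P ≤ n
count-≤ {n} P = ≤-trans (count-mono {P = P} (λ _ _ → refl)) (≤-reflexive (count-true n))

count-∩-≤ʳ : ∀ {n} (P Q : Fin n → Bool) → count (P ∩ Q) ≤ count Q
count-∩-≤ʳ P Q = count-mono (λ i → ∧-conicalʳ (P i) (Q i))

count-split : ∀ {n} (P Q : Fin n → Bool) → count P ≡ count (P ∩ Q) + count (P ∩ ∁ Q)
count-split {zero}  P Q = refl
count-split {suc n} P Q with P zero | Q zero | count-split (P ∘ suc) (Q ∘ suc)
... | true  | true  | ih = cong suc ih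
... | true  | false | ih = trans (cong suc ih) (sym (+-suc _ _))
... | false | true  | ih = ih
... | false | false | ih = ih

count-complement : ∀ {n} (P : Fin n → Bool) → count P + count (∁ P) ≡ n
count-complement {n} P = sym (trans (sym (count-true n)) (count-split (λ _ → true) P))

count-++ : ∀ m n (P : Fin (m + n) → Bool) →
  count P ≡ count (λ i → P (i ↑ˡ n)) + count (λ j → P (m ↑ʳ j))
count-++ zero    n P = refl
count-++ (suc m) n P with P zero
... | true  = cong suc (count-++ m n (P ∘ suc))
... | false = count-++ m n (P ∘ suc)

count-<ᵇ : ∀ n k → k ≤ n → count {n} (λ i → toℕ i <ᵇ k) ≡ k
count-<ᵇ n       zero    _         = count-false n
count-<ᵇ (suc n) (suc k) (s≤s k≤n) = cong suc (count-<ᵇ n k k≤n)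

count-≡ᵇ : ∀ n k → k < n → count {n} (λ i → toℕ i ≡ᵇ k) ≡ 1
count-≡ᵇ (suc n) zero    _         = cong suc (count-false n)
count-≡ᵇ (suc n) (suc k) (s≤s k<n) = count-≡ᵇ n k k<n

count≥1⇒∃ : ∀ {n} (P : Fin n → Bool) → 1 ≤ count P → Σ (Fin n) λ i → P i ≡ true
count≥1⇒∃ {suc n} P 1≤P with P zero in P₀
... | true  = zero , P₀
... | false with count≥1⇒∃ (P ∘ suc) 1≤P
...   | i , Pi = suc i , Pi

count≥2⇒∃₂ : ∀ {n} (P : Fin n → Bool) → 2 ≤ count P →
  Σ (Fin n) λ i → Σ (Fin n) λ j → ¬ i ≡ j × P i ≡ true × P j ≡ true
count≥2⇒∃₂ {suc n} P 2≤P with P zero in P₀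
... | true with count≥1⇒∃ (P ∘ suc) (s≤s⁻¹ 2≤P)
...   | j , Pj = zero , suc j , (λ ()) , P₀ , Pj
count≥2⇒∃₂ {suc n} P 2≤P | false with count≥2⇒∃₂ (P ∘ suc) 2≤P
...   | i , j , i≢j , Pi , Pj = suc i , suc j , i≢j ∘ suc-injective , Pi , Pj

[n+n]/2≡n : ∀ n → (n + n) / 2 ≡ n
[n+n]/2≡n n = begin
  (n + n) / 2       ≡⟨ cong (λ m → (n + m) / 2) (sym (+-identityʳ n)) ⟩
  (2 * n) / 2       ≡⟨ cong (_/ 2) (*-comm 2 n) ⟩
  (n * 2) / 2       ≡⟨ m*n/n≡m n 2 ⟩
  n                 ∎
  where open ≡-Reasoning

module _ (G : Graph) (S : VSet G) where

  Pendant : Fin (order G) → Set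
  Pendant y = ∀ u w → S u ≡ true → S w ≡ true → adj G y u ≡ true → adj G y w ≡ true → u ≡ w

  StarLike : Set
  StarLike = ∀ y → S y ≡ true → Pendant y ⊎ (∀ z → S z ≡ true → adj G y z ≡ true → Pendant z)

  -- On a cycle x y z …, the vertex y has the two distinct neighbours x and z,
  -- so z must be pendant; but z is adjacent to y and to its own successor.
  starLike⇒forest : StarLike → InducesForest G S
  starLike⇒forest starLike (x , y ∷ [] , s≤s () , _)
  starLike⇒forest starLike (x , y ∷ z ∷ rest , _ , (x∉@(_ ∷ x≢z ∷ _) ∷ y∉ ∷ _) , (Sx ∷ Sy ∷ Sz ∷ Srest) , (xy , yz , walk))
    with starLike y Sy
  ... | inj₁ y-pendant = x≢z (y-pendant x z Sx Sz (trans (symm G y x) xy) yz)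
  ... | inj₂ nbrs-pendant = around rest Srest y∉ x∉ walk
    where
      z-pendant : Pendant z
      z-pendant = nbrs-pendant z Sz yz
      zy : adj G z y ≡ true
      zy = trans (symm G z y) yz
      around : ∀ r → All (λ v → S v ≡ true) r → All (λ v → ¬ y ≡ v) (z ∷ r) →
               All (λ v → ¬ x ≡ v) (y ∷ z ∷ r) → Walk G (z ∷ r ++ [ x ]) → ⊥
      around []      _          _             (x≢y ∷ _) (zx , _) = x≢y (sym (z-pendant y x Sy Sx zy zx))
      around (w ∷ r) (Sw ∷ _)   (_ ∷ y≢w ∷ _) _         (zw , _) = y≢w (z-pendant y w Sy Sw zy zw)

module Biadjacency (p : ℕ) (R : Fin p → Fin p → Bool) where

  adj⊎ : Fin p ⊎ Fin p → Fin p ⊎ Fin p → Bool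
  adj⊎ (inj₁ i) (inj₂ j) = R i j
  adj⊎ (inj₂ j) (inj₁ i) = R i j
  adj⊎ _        _        = false

  adj⊎-sym : ∀ u v → adj⊎ u v ≡ adj⊎ v u
  adj⊎-sym (inj₁ i) (inj₁ j) = refl
  adj⊎-sym (inj₁ i) (inj₂ j) = refl
  adj⊎-sym (inj₂ i) (inj₁ j) = refl
  adj⊎-sym (inj₂ i) (inj₂ j) = refl

  adj⊎-irrefl : ∀ v → adj⊎ v v ≡ false
  adj⊎-irrefl (inj₁ i) = refl
  adj⊎-irrefl (inj₂ i) = refl

  G : Graph
  G = record
    { order  = p + p
    ; adj    = λ u v → adj⊎ (splitAt p u) (splitAt p v)
    ; symm   = λ u v → adj⊎-sym (splitAt p u) (splitAt p v)
    ; irrefl = λ v → adj⊎-irrefl (splitAt p v)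
    }

  A B : Fin p → Fin (p + p)
  A i = i ↑ˡ p
  B j = p ↑ʳ j

  adj-AA : ∀ i i′ → adj G (A i) (A i′) ≡ false
  adj-AA i i′ rewrite splitAt-↑ˡ p i p | splitAt-↑ˡ p i′ p = refl

  adj-BB : ∀ j j′ → adj G (B j) (B j′) ≡ false
  adj-BB j j′ rewrite splitAt-↑ʳ p p j | splitAt-↑ʳ p p j′ = refl

  adj-AB : ∀ i j → adj G (A i) (B j) ≡ R i j
  adj-AB i j rewrite splitAt-↑ˡ p i p | splitAt-↑ʳ p p j = refl

  adj-BA : ∀ j i → adj G (B j) (A i) ≡ R i j
  adj-BA j i rewrite splitAt-↑ˡ p i p | splitAt-↑ʳ p p j = refl

  vertex-view : ∀ v → (Σ (Fin p) λ i → v ≡ A i) ⊎ (Σ (Fin p) λ j → v ≡ B j)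
  vertex-view v with splitAt p v | join-splitAt p p v
  ... | inj₁ i | eq = inj₁ (i , sym eq)
  ... | inj₂ j | eq = inj₂ (j , sym eq)

  A≢B : ∀ i j → ¬ A i ≡ B j
  A≢B i j eq with trans (sym (splitAt-↑ˡ p i p)) (trans (cong (splitAt p) eq) (splitAt-↑ʳ p p j))
  ... | ()

  count-vertices : (S : VSet G) → count S ≡ count (S ∘ A) + count (S ∘ B)
  count-vertices = count-++ p p

  side : VSet G
  side v with splitAt p v
  ... | inj₁ _ = true
  ... | inj₂ _ = false

  balanced : BalancedBipartite G
  balanced = side , proper , equal-sides
    where
      proper : ∀ u v → adj G u v ≡ true → ¬ side u ≡ side v
      proper u v uv with splitAt p u | splitAt p v
      proper u v () | inj₁ _ | inj₁ _
      proper u v _  | inj₁ _ | inj₂ _ = λ ()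
      proper u v _  | inj₂ _ | inj₁ _ = λ ()
      proper u v () | inj₂ _ | inj₂ _
      side-A : ∀ i → side (A i) ≡ true
      side-A i rewrite splitAt-↑ˡ p i p = refl
      side-B : ∀ j → side (B j) ≡ false
      side-B j rewrite splitAt-↑ʳ p p j = refl
      equal-sides : count side ≡ count (∁ side)
      equal-sides = begin
        count side
          ≡⟨ count-vertices side ⟩
        count (side ∘ A) + count (side ∘ B)
          ≡⟨ cong₂ _+_ (trans (count-cong side-A) (count-true p)) (trans (count-cong side-B) (count-false p)) ⟩
        p + 0
          ≡⟨ +-comm p 0 ⟩
        0 + p
          ≡⟨ cong₂ _+_ (trans (count-cong (cong not ∘ side-A)) (count-false p))
                       (trans (count-cong (cong not ∘ side-B)) (count-true p)) ⟨
        count (∁ side ∘ A) + count (∁ side ∘ B)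
          ≡⟨ count-vertices (∁ side) ⟨
        count (∁ side) ∎
        where open ≡-Reasoning

  degree-A : ∀ i → degree G (A i) ≡ count (R i)
  degree-A i = trans (count-vertices (adj G (A i)))
    (cong₂ _+_ (trans (count-cong (adj-AA i)) (count-false p)) (count-cong (adj-AB i)))

  degree-B : ∀ j → degree G (B j) ≡ count (λ i → R i j)
  degree-B j = trans (count-vertices (adj G (B j)))
    (trans (cong₂ _+_ (count-cong (adj-BA j)) (trans (count-cong (adj-BB j)) (count-false p)))
           (+-identityʳ _))

  minDegreeIs : ∀ k → (∀ i → k ≤ count (R i)) → (∀ j → k ≤ count (λ i → R i j)) →
    ∀ i₀ → count (R i₀) ≡ k → MinDegreeIs G k
  minDegreeIs k rows columns i₀ row₀ = bound , A i₀ , trans (degree-A i₀) row₀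
    where
      bound : ∀ v → k ≤ degree G v
      bound v with vertex-view v
      ... | inj₁ (i , refl) = subst (k ≤_) (sym (degree-A i)) (rows i)
      ... | inj₂ (j , refl) = subst (k ≤_) (sym (degree-B j)) (columns j)

  square : (S : VSet G) → ∀ a₁ a₂ b₁ b₂ → ¬ a₁ ≡ a₂ → ¬ b₁ ≡ b₂ →
    S (A a₁) ≡ true → S (A a₂) ≡ true → S (B b₁) ≡ true → S (B b₂) ≡ true →
    R a₁ b₁ ≡ true → R a₂ b₁ ≡ true → R a₂ b₂ ≡ true → R a₁ b₂ ≡ true → CycleIn G S
  square S a₁ a₂ b₁ b₂ a₁≢a₂ b₁≢b₂ Sa₁ Sa₂ Sb₁ Sb₂ r₁₁ r₂₁ r₂₂ r₁₂ =
    A a₁ , B b₁ ∷ A a₂ ∷ B b₂ ∷ [] , s≤s (s≤s z≤n)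
    , ( (A≢B a₁ b₁ ∷ a₁≢a₂ ∘ ↑ˡ-injective p a₁ a₂ ∷ A≢B a₁ b₂ ∷ [])
      ∷ (A≢B a₂ b₁ ∘ sym ∷ b₁≢b₂ ∘ ↑ʳ-injective p b₁ b₂ ∷ [])
      ∷ (A≢B a₂ b₂ ∷ [])
      ∷ [] ∷ [])
    , (Sa₁ ∷ Sb₁ ∷ Sa₂ ∷ Sb₂ ∷ [])
    , ( trans (adj-AB a₁ b₁) r₁₁ , trans (adj-BA b₁ a₂) r₂₁
      , trans (adj-AB a₂ b₂) r₂₂ , trans (adj-BA b₂ a₁) r₁₂ , tt)

  forest⇒no-K₂₂ : ∀ {S} → InducesForest G S → (P Q : Fin p → Bool) →
    (∀ i → P i ≡ true → S (A i) ≡ true) → (∀ j → Q j ≡ true → S (B j) ≡ true) →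
    (∀ i j → P i ≡ true → Q j ≡ true → R i j ≡ true) →
    count P ≤ 1 ⊎ count Q ≤ 1
  forest⇒no-K₂₂ {S} forest P Q P⊆S Q⊆S complete with 2 ≤? count P | 2 ≤? count Q
  ... | no 2≰P | _      = inj₁ (s≤s⁻¹ (≰⇒> 2≰P))
  ... | yes _  | no 2≰Q = inj₂ (s≤s⁻¹ (≰⇒> 2≰Q))
  ... | yes 2≤P | yes 2≤Q with count≥2⇒∃₂ P 2≤P | count≥2⇒∃₂ Q 2≤Q
  ...   | a₁ , a₂ , a₁≢a₂ , Pa₁ , Pa₂ | b₁ , b₂ , b₁≢b₂ , Qb₁ , Qb₂ =
    ⊥-elim (forest (square S a₁ a₂ b₁ b₂ a₁≢a₂ b₁≢b₂
      (P⊆S a₁ Pa₁) (P⊆S a₂ Pa₂) (Q⊆S b₁ Qb₁) (Q⊆S b₂ Qb₂)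
      (complete a₁ b₁ Pa₁ Qb₁) (complete a₂ b₁ Pa₂ Qb₁)
      (complete a₂ b₂ Pa₂ Qb₂) (complete a₁ b₂ Pa₁ Qb₂)))

  forest-block-bound : ∀ {S} → InducesForest G S → (P Q : Fin p → Bool) {n : ℕ} →
    (∀ i j → P i ≡ true → Q j ≡ true → R i j ≡ true) → count P ≤ n → count Q ≤ n →
    count ((S ∘ A) ∩ P) + count ((S ∘ B) ∩ Q) ≤ n + 1
  forest-block-bound {S} forest P Q {n} complete P≤n Q≤n
    with forest⇒no-K₂₂ forest ((S ∘ A) ∩ P) ((S ∘ B) ∩ Q)
           (λ i → ∧-conicalˡ _ _) (λ j → ∧-conicalˡ _ _)
           (λ i j SPi SQj → complete i j (∧-conicalʳ _ _ SPi) (∧-conicalʳ _ _ SQj))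
  ... | inj₁ SP≤1 = ≤-trans (+-mono-≤ SP≤1 (≤-trans (count-∩-≤ʳ (S ∘ B) Q) Q≤n)) (≤-reflexive (+-comm 1 n))
  ... | inj₂ SQ≤1 = +-mono-≤ (≤-trans (count-∩-≤ʳ (S ∘ A) P) P≤n) SQ≤1

  A∪_ : (Fin p → Bool) → VSet G
  (A∪ T) v with splitAt p v
  ... | inj₁ _ = true
  ... | inj₂ j = T j

  A⊆A∪ : ∀ T i → (A∪ T) (A i) ≡ true
  A⊆A∪ T i rewrite splitAt-↑ˡ p i p = refl

  A∪-B : ∀ T j → (A∪ T) (B j) ≡ T j
  A∪-B T j rewrite splitAt-↑ʳ p p j = refl

  count-A∪ : ∀ T → count (A∪ T) ≡ p + count T
  count-A∪ T = trans (count-vertices (A∪ T))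
    (cong₂ _+_ (trans (count-cong (A⊆A∪ T)) (count-true p)) (count-cong (A∪-B T)))

  OneNeighbourIn : (Fin p → Bool) → Set
  OneNeighbourIn T = ∀ i j₁ j₂ → T j₁ ≡ true → T j₂ ≡ true → R i j₁ ≡ true → R i j₂ ≡ true → j₁ ≡ j₂

  A∪-forest : ∀ T → OneNeighbourIn T → InducesForest G (A∪ T)
  A∪-forest T one = starLike⇒forest G (A∪ T) starLike
    where
      neighbour-in-T : ∀ i u → (A∪ T) u ≡ true → adj G (A i) u ≡ true →
        Σ (Fin p) λ j → u ≡ B j × T j ≡ true × R i j ≡ true
      neighbour-in-T i u Su au with vertex-view u
      ... | inj₁ (i′ , refl) with () ← trans (sym au) (adj-AA i i′)
      ... | inj₂ (j , refl) = j , refl , trans (sym (A∪-B T j)) Su , trans (sym (adj-AB i j)) au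
      A-pendant : ∀ i → Pendant G (A∪ T) (A i)
      A-pendant i u w Su Sw au aw with neighbour-in-T i u Su au | neighbour-in-T i w Sw aw
      ... | j₁ , refl , Tj₁ , Rij₁ | j₂ , refl , Tj₂ , Rij₂ = cong B (one i j₁ j₂ Tj₁ Tj₂ Rij₁ Rij₂)
      starLike : StarLike G (A∪ T)
      starLike y _ with vertex-view y
      ... | inj₁ (i , refl) = inj₁ (A-pendant i)
      ... | inj₂ (j , refl) = inj₂ nbrs-pendant
        where
          nbrs-pendant : ∀ z → (A∪ T) z ≡ true → adj G (B j) z ≡ true → Pendant G (A∪ T) z
          nbrs-pendant z _ bz with vertex-view z
          ... | inj₁ (i , refl) = A-pendant i
          ... | inj₂ (j′ , refl) with () ← trans (sym bz) (adj-BB j j′)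

  forestNumberIs : ∀ T {m} → OneNeighbourIn T → count T ≡ m →
    (∀ S → InducesForest G S → count S ≤ p + m) → ForestNumberIs G (order G / 2 + m)
  forestNumberIs T one refl upper =
    subst (λ half → ForestNumberIs G (half + count T)) (sym ([n+n]/2≡n p))
      ((A∪ T , A∪-forest T one , count-A∪ T) , upper)

Witness : (k l N : ℕ) → Set
Witness k l N = Σ Graph λ G →
  N ≤ order G × BalancedBipartite G × MinDegreeIs G k × ForestNumberIs G (order G / 2 + l)

module ForestNumberPlusOne (k N : ℕ) (2≤k : 2 ≤ k) where

  q p : ℕ
  q = k + N
  p = suc q

  X : Fin p → Bool
  X i = toℕ i <ᵇ k

  nonzero : Fin p → Bool
  nonzero zero    = false
  nonzero (suc _) = true

  R : Fin p → Fin p → Bool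
  R i j = nonzero i ∨ X j

  open Biadjacency p R

  count-X : count X ≡ k
  count-X = count-<ᵇ p k (m≤n⇒m≤1+n (m≤m+n k N))

  count-nonzero : count nonzero ≡ q
  count-nonzero = count-true q

  count-∁nonzero : count (∁ nonzero) ≡ 1
  count-∁nonzero = cong suc (count-false q)

  X⊆row : ∀ i j → X j ≡ true → R i j ≡ true
  X⊆row i j Xj = trans (cong (nonzero i ∨_) Xj) (∨-zeroʳ (nonzero i))

  nonzero⊆column : ∀ i j → nonzero i ≡ true → R i j ≡ true
  nonzero⊆column i j nz = cong (_∨ X j) nz

  row-degree : ∀ i → k ≤ count (R i)
  row-degree i = subst (_≤ count (R i)) count-X (count-mono (X⊆row i))

  column-degree : ∀ j → k ≤ count (λ i → R i j)
  column-degree j = ≤-trans (m≤m+n k N)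
    (subst (_≤ count (λ i → R i j)) count-nonzero (count-mono (λ i → nonzero⊆column i j)))

  only-zero : OneNeighbourIn (∁ nonzero)
  only-zero i zero    zero    _  _  _ _ = refl
  only-zero i zero    (suc _) _  () _ _
  only-zero i (suc _) _       () _  _ _

  upper : ∀ S → InducesForest G S → count S ≤ p + 1
  upper S forest
    with forest⇒no-K₂₂ forest ((S ∘ A) ∩ nonzero) (S ∘ B)
           (λ _ → ∧-conicalˡ _ _) (λ _ Sj → Sj) (λ i j Snz _ → nonzero⊆column i j (∧-conicalʳ _ _ Snz))
  ... | inj₂ SB≤1 = begin
    count S                       ≡⟨ count-vertices S ⟩
    count (S ∘ A) + count (S ∘ B) ≤⟨ +-mono-≤ (count-≤ (S ∘ A)) SB≤1 ⟩
    p + 1                         ∎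
    where open ≤-Reasoning
  ... | inj₁ SA⁺≤1
    with forest⇒no-K₂₂ forest (S ∘ A) ((S ∘ B) ∩ X)
           (λ _ Si → Si) (λ _ → ∧-conicalˡ _ _) (λ i j _ SXj → X⊆row i j (∧-conicalʳ _ _ SXj))
  ...   | inj₁ SA≤1 = begin
    count S                       ≡⟨ count-vertices S ⟩
    count (S ∘ A) + count (S ∘ B) ≤⟨ +-mono-≤ SA≤1 (count-≤ (S ∘ B)) ⟩
    1 + p                         ≡⟨ +-comm 1 p ⟩
    p + 1                         ∎
    where open ≤-Reasoning
  ...   | inj₂ SBX≤1 = begin
    count S
      ≡⟨ count-vertices S ⟩
    count (S ∘ A) + count (S ∘ B)
      ≡⟨ cong₂ _+_ (count-split (S ∘ A) nonzero) (count-split (S ∘ B) X) ⟩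
    (count ((S ∘ A) ∩ nonzero) + count ((S ∘ A) ∩ ∁ nonzero)) + (count ((S ∘ B) ∩ X) + count ((S ∘ B) ∩ ∁ X))
      ≤⟨ +-mono-≤ (+-mono-≤ SA⁺≤1 (≤-trans (count-∩-≤ʳ (S ∘ A) (∁ nonzero)) (≤-reflexive count-∁nonzero)))
                  (+-mono-≤ SBX≤1 (count-∩-≤ʳ (S ∘ B) (∁ X))) ⟩
    1 + (2 + count (∁ X))
      ≤⟨ +-monoʳ-≤ 1 (+-monoˡ-≤ (count (∁ X)) (subst (2 ≤_) (sym count-X) 2≤k)) ⟩
    1 + (count X + count (∁ X))
      ≡⟨ cong (1 +_) (count-complement X) ⟩
    1 + p
      ≡⟨ +-comm 1 p ⟩
    p + 1 ∎
    where open ≤-Reasoning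

  witness : Witness k 1 N
  witness = G
    , ≤-trans (m≤n+m N k) (≤-trans (n≤1+n q) (m≤m+n p p))
    , balanced
    , minDegreeIs k row-degree column-degree zero count-X
    , forestNumberIs (∁ nonzero) only-zero count-∁nonzero upper

module ForestNumberPlusTwo (k′ N : ℕ) where

  k m p : ℕ
  k = suc k′
  m = k + N
  p = k + m

  X : Fin p → Bool
  X i = toℕ i <ᵇ k

  R : Fin p → Fin p → Bool
  R i j = if X i then X j else not (X j)

  open Biadjacency p R

  R-sym : ∀ i j → R i j ≡ R j i
  R-sym i j with X i | X j
  ... | true  | true  = refl
  ... | true  | false = refl
  ... | false | true  = refl
  ... | false | false = refl

  R⇒same-side : ∀ i j → R i j ≡ true → X i ≡ X j
  R⇒same-side i j Rij with X i | X j
  R⇒same-side i j _  | true  | true  = refl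
  R⇒same-side i j () | true  | false
  R⇒same-side i j () | false | true
  R⇒same-side i j _  | false | false = refl

  same-side⇒R : ∀ i j → X i ≡ X j → R i j ≡ true
  same-side⇒R i j Xi≡Xj with X i | X j
  same-side⇒R i j _  | true  | true  = refl
  same-side⇒R i j () | true  | false
  same-side⇒R i j () | false | true
  same-side⇒R i j _  | false | false = refl

  count-X : count X ≡ k
  count-X = count-<ᵇ p k (m≤m+n k m)

  count-∁X : count (∁ X) ≡ m
  count-∁X = +-cancelˡ-≡ k _ _ (trans (cong (_+ count (∁ X)) (sym count-X)) (count-complement X))

  row-degree : ∀ i → k ≤ count (R i)
  row-degree i with X i
  ... | true  = ≤-reflexive (sym count-X)
  ... | false = subst (k ≤_) (sym count-∁X) (m≤m+n k N)

  column-degree : ∀ j → k ≤ count (λ i → R i j)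
  column-degree j = subst (k ≤_) (count-cong (R-sym j)) (row-degree j)

  -- b₀ and b_k: one B-vertex in each block.
  T : Fin p → Bool
  T zero    = true
  T (suc j) = toℕ j ≡ᵇ k′

  count-T : count T ≡ 2
  count-T = cong suc (count-≡ᵇ (k′ + m) k′ (m<m+n k′ z<s))

  T-suc : ∀ j → T (suc j) ≡ true → toℕ j ≡ k′
  T-suc j Tj = ≡ᵇ⇒≡ (toℕ j) k′ (subst Data.Bool.T (sym Tj) tt)

  T-suc∉X : ∀ j → T (suc j) ≡ true → ¬ X (suc j) ≡ true
  T-suc∉X j Tj Xj = <-irrefl (T-suc j Tj) (<ᵇ⇒< (toℕ j) k′ (subst Data.Bool.T (sym Xj) tt))

  T-separated : ∀ j₁ j₂ → T j₁ ≡ true → T j₂ ≡ true → X j₁ ≡ X j₂ → j₁ ≡ j₂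
  T-separated zero      zero      _   _   _     = refl
  T-separated zero      (suc j)   _   Tj  X≡X   = ⊥-elim (T-suc∉X j Tj (sym X≡X))
  T-separated (suc j)   zero      Tj  _   X≡X   = ⊥-elim (T-suc∉X j Tj X≡X)
  T-separated (suc j₁)  (suc j₂)  Tj₁ Tj₂ _     = cong suc (toℕ-injective (trans (T-suc j₁ Tj₁) (sym (T-suc j₂ Tj₂))))

  one-per-block : OneNeighbourIn T
  one-per-block i j₁ j₂ Tj₁ Tj₂ Rij₁ Rij₂ =
    T-separated j₁ j₂ Tj₁ Tj₂ (trans (sym (R⇒same-side i j₁ Rij₁)) (R⇒same-side i j₂ Rij₂))

  upper : ∀ S → InducesForest G S → count S ≤ p + 2
  upper S forest = begin
    count S
      ≡⟨ count-vertices S ⟩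
    count (S ∘ A) + count (S ∘ B)
      ≡⟨ cong₂ _+_ (count-split (S ∘ A) X) (count-split (S ∘ B) X) ⟩
    (a X + a (∁ X)) + (b X + b (∁ X))
      ≡⟨ interchange (a X) (a (∁ X)) (b X) (b (∁ X)) ⟩
    (a X + b X) + (a (∁ X) + b (∁ X))
      ≤⟨ +-mono-≤ (forest-block-bound forest X X X-block (≤-reflexive count-X) (≤-reflexive count-X))
                  (forest-block-bound forest (∁ X) (∁ X) ∁X-block (≤-reflexive count-∁X) (≤-reflexive count-∁X)) ⟩
    (k + 1) + (m + 1)
      ≡⟨ interchange k 1 m 1 ⟩
    p + 2 ∎
    where
      open ≤-Reasoning
      a b : (Fin p → Bool) → ℕ
      a P = count ((S ∘ A) ∩ P)
      b Q = count ((S ∘ B) ∩ Q)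
      X-block : ∀ i j → X i ≡ true → X j ≡ true → R i j ≡ true
      X-block i j Xi Xj = same-side⇒R i j (trans Xi (sym Xj))
      ∁X-block : ∀ i j → not (X i) ≡ true → not (X j) ≡ true → R i j ≡ true
      ∁X-block i j ∁Xi ∁Xj = same-side⇒R i j (not-injective (trans ∁Xi (sym ∁Xj)))

  witness : Witness k 2 N
  witness = G
    , ≤-trans (m≤n+m N k) (≤-trans (m≤n+m m k) (m≤m+n p p))
    , balanced
    , minDegreeIs k row-degree column-degree zero count-X
    , forestNumberIs T one-per-block count-T upper

theorem5 : (k l : ℕ) → 2 ≤ k → (l ≡ 1 ⊎ l ≡ 2) →
    (N : ℕ) → Σ Graph λ G →
      N ≤ order G × BalancedBipartite G × MinDegreeIs G k
      × ForestNumberIs G (order G / 2 + l)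
theorem5 k        .1 2≤k (inj₁ refl) N = ForestNumberPlusOne.witness k N 2≤k
theorem5 (suc k′) .2 _   (inj₂ refl) N = ForestNumberPlusTwo.witness k′ N
theorem5 zero     .2 ()  (inj₂ refl) N
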